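{- For every graph $G$, $\zeta_1(G)\le \mathrm{pw}(G)$.
   Context: All graphs are finite, connected, and without multiple edges. For a vertex $x$, $N(x)$ is its set of neighbours ($x\notin N(x)$) and $N[x]=N(x)\cup\{x\}$. The one-visibility Localization game with $k$ cops on a graph $G$: the robber first chooses a starting vertex; then in each round the cops choose (probe) vertices $u_1,\dots,u_k$ of $G$ (any vertices), and for each $i$ the probe returns $0$ if the robber is on $u_i$, $1$ if the robber is adjacent to $u_i$, and $\ast$ otherwise; then the robber moves to a vertex of $N[v]$, where $v$ is its current vertex. The cops win if after finitely many rounds the information obtained determines the robber's current vertex uniquely; the robber is omniscient. $\zeta_1(G)$ is the least positive integer $k$ such that $k$ cops have a winning strategy. A path-decomposition of $G$ is a sequence of bags $B_1,\dots,B_n\subseteq V(G)$ (arranged along a path) with $\bigcup_i B_i=V(G)$, every edge contained in some bag, and $B_i\cap B_j\subseteq B_k$ whenever $i\le k\le j$; its width is the largest bag size minus $1$, and $\mathrm{pw}(G)$ is the minimum width of a path-decomposition of $G$. -}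

module Defs where

open import Data.Nat using (ℕ; zero; suc)
import Data.Nat as ℕ
open import Data.Bool using (Bool; true; false; if_then_else_)
open import Data.Fin using (Fin; _≟_)
import Data.Fin as Fin
open import Data.Fin.Subset using (Subset; _∈_; _∩_; _⊆_; ∣_∣)
open import Data.Vec using (Vec; _∷_)
import Data.Vec as Vec
open import Data.List using (List; []; _∷_)
open import Data.Product using (Σ; ∃; ∃-syntax; _×_; proj₁)
open import Data.Sum using (_⊎_)
open import Relation.Binary.PropositionalEquality using (_≡_)
open import Relation.Nullary using (yes; no)

data Reachable {n : ℕ} (adj : Fin n → Fin n → Bool) : Fin n → Fin n → Set where
  here : ∀ {x} → Reachable adj x x
  step : ∀ {x y z} → adj x y ≡ true → Reachable adj y z → Reachable adj x z

record Graph : Set where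
  field
    n         : ℕ
    adj       : Fin n → Fin n → Bool
    adj-sym   : ∀ x y → adj x y ≡ adj y x
    adj-irr   : ∀ x → adj x x ≡ false
    connected : ∀ x y → Reachable adj x y

module _ (G : Graph) where
  open Graph G

  InClosedNbhd : Fin n → Fin n → Set
  InClosedNbhd v w = (w ≡ v) ⊎ (adj v w ≡ true)

  -- probe answers: onV = 0, adjV = 1, farV = ∗
  data Resp : Set where
    onV adjV farV : Resp

  probe : Fin n → Fin n → Resp
  probe u r with u ≟ r
  ... | yes _ = onV
  ... | no  _ = if adj u r then adjV else farV

  -- deterministic strategy of k cops: the probed vertices of the next round
  -- as a function of the history of answers so far (most recent first)
  Strategy : ℕ → Set
  Strategy k = List (Vec Resp k) → Vec (Fin n) k

  RobberWalk : Set
  RobberWalk = Σ (ℕ → Fin n) λ v → ∀ t → InClosedNbhd (v t) (v (suc t))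

  -- answers obtained in rounds 0 .. t-1 (most recent first)
  history : ∀ {k} → Strategy k → (ℕ → Fin n) → ℕ → List (Vec Resp k)
  history σ v zero    = []
  history σ v (suc t) =
    Vec.map (λ u → probe u (v t)) (σ (history σ v t)) ∷ history σ v t

  -- after the probes of round t, the information determines the robber's
  -- current vertex: every robber trajectory yielding the same answers is
  -- at the same vertex in round t
  LocatedAt : ∀ {k} → Strategy k → (ℕ → Fin n) → ℕ → Set
  LocatedAt σ v t = ∀ (u : RobberWalk) →
    history σ (proj₁ u) (suc t) ≡ history σ v (suc t) → proj₁ u t ≡ v t

  CopsWin : ℕ → Set
  CopsWin k = Σ (Strategy k) λ σ → ∀ (v : RobberWalk) → ∃[ t ] LocatedAt σ (proj₁ v) t

  record PathDecomposition : Set where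
    field
      m      : ℕ
      bag    : Fin m → Subset n
      covers : ∀ x → ∃[ i ] (x ∈ bag i)
      edges  : ∀ x y → adj x y ≡ true → ∃[ i ] (x ∈ bag i × y ∈ bag i)
      interp : ∀ i j k → i Fin.≤ k → k Fin.≤ j → (bag i ∩ bag j) ⊆ bag k

  HasPathDecompOfWidth≤ : ℕ → Set
  HasPathDecompOfWidth≤ w = Σ PathDecomposition λ D →
    ∀ i → ∣ PathDecomposition.bag D i ∣ ℕ.≤ suc w

  IsPathwidth : ℕ → Set
  IsPathwidth w = HasPathDecompOfWidth≤ w × (∀ w' → HasPathDecompOfWidth≤ w' → w ℕ.≤ w')

-- Number the vertices by the last bag containing them (ties broken by the vertex itself) and let the
-- cops clear them in this order, one vertex per round, while keeping the robber inside the uncleared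
-- part. In the round that clears x, the uncleared vertices from which the robber could step into the
-- cleared part all lie in the last bag of x. That bag has at most w + 1 vertices, and one of them may
-- stay unprobed: either it is a neighbour y of x, and the answer of the probe at x tells whether the
-- robber sits on y, or x has no uncleared neighbour and w probes on the last bag of the previously
-- cleared vertex already guard the cleared part. Once every vertex is cleared the robber has been
-- located.
module Submission where

open import Data.Bool using (true; false; if_then_else_)
import Data.Bool.Properties as Bool
open import Data.Fin as Fin using (Fin; zero; suc; toℕ; combine; punchIn)
open import Data.Fin.Properties
  using (any?; toℕ<n; toℕ-injective; combine-monoˡ-<; combine-injectiveʳ; punchInᵢ≢i)
open import Data.Fin.Subset using (Subset; inside; outside; _∈_; _∉_; _-_; ∣_∣; ⊥)
open import Data.Fin.Subset.Properties using (_∈?_; x∈p∩q⁺; x∈p∧x≢y⇒x∈p-y; x∈p⇒∣p-x∣<∣p∣; ∣⊥∣≡0)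
open import Data.List using (List; length; filter; allFin)
open import Data.List.Properties using (∷-injectiveˡ; ∷-injectiveʳ)
open import Data.List.Extrema.Nat using (argmax; argmax-all; f[xs]≤f[argmax])
open import Data.List.Membership.Propositional.Properties using (∈-filter⁺; ∈-allFin)
import Data.List.Relation.Unary.All as All
open import Data.List.Relation.Unary.All.Properties using (all-filter)
open import Data.Nat as ℕ using (ℕ; suc; _*_; _≤_; _<_; z≤n; s≤s; _≤?_; _<?_)
open import Data.Nat.Properties
  using (≤-refl; ≤-trans; <⇒≤; ≤-antisym; ≤-pred; <⇒≱; ≮⇒≥; ≰⇒>; <-≤-trans; m≤n⇒m<n∨m≡n)
open import Data.Product using (∃; ∃-syntax; _×_; _,_; proj₁; proj₂)
open import Data.Sum using (_⊎_; inj₁; inj₂; [_,_])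
open import Data.Vec as Vec using (Vec; []; _∷_; padRight)
import Data.Vec.Properties as Vec
open import Data.Vec.Membership.Propositional using () renaming (_∈_ to _∈ᵥ_)
open import Data.Vec.Membership.Propositional.Properties using (∈-map⁺)
open import Data.Vec.Relation.Unary.Any using (here; there)
open import Relation.Binary.PropositionalEquality hiding ([_])
open import Relation.Nullary using (Dec; yes; no; ¬_; contradiction)
open import Relation.Nullary.Decidable using (_×-dec_)
open import Relation.Unary using (Pred; Decidable)

open import Defs

maxBy : ∀ {n ℓ} (f : Fin n → ℕ) {P : Pred (Fin n) ℓ} → Decidable P → ∃ P →
        ∃ λ p → P p × ∀ {i} → P i → f i ≤ f p
maxBy {n} f {P} P? (i , Pi) =
  argmax f i candidates , argmax-all f Pi (all-filter P? (allFin n)) , greatest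
  where
  candidates : List (Fin n)
  candidates = filter P? (allFin n)

  greatest : ∀ {j} → P j → f j ≤ f (argmax f i candidates)
  greatest Pj = All.lookup (f[xs]≤f[argmax] i candidates) (∈-filter⁺ P? (∈-allFin _) Pj)

elements : ∀ {n} (p : Subset n) → Vec (Fin n) ∣ p ∣
elements []            = []
elements (inside ∷ p)  = zero ∷ Vec.map suc (elements p)
elements (outside ∷ p) = Vec.map suc (elements p)

∈-elements : ∀ {n} {x : Fin n} {p : Subset n} → x ∈ p → x ∈ᵥ elements p
∈-elements {p = inside ∷ p}  Vec.here        = here refl
∈-elements {p = inside ∷ p}  (Vec.there x∈p) = there (∈-map⁺ suc (∈-elements x∈p))
∈-elements {p = outside ∷ p} (Vec.there x∈p) = ∈-map⁺ suc (∈-elements x∈p)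

∈-padRight : ∀ {a} {A : Set a} {m k} (m≤k : m ≤ k) (d : A) {x} {xs : Vec A m} →
             x ∈ᵥ xs → x ∈ᵥ padRight m≤k d xs
∈-padRight (s≤s m≤k) d (here x≡y)  = here x≡y
∈-padRight (s≤s m≤k) d (there x∈) = there (∈-padRight m≤k d x∈)

map-≡⇒≡-on-∈ : ∀ {a b} {A : Set a} {B : Set b} {f g : A → B} {m} {xs : Vec A m} {x} →
               Vec.map f xs ≡ Vec.map g xs → x ∈ᵥ xs → f x ≡ g x
map-≡⇒≡-on-∈ {xs = _ ∷ _} eq (here refl) = Vec.∷-injectiveˡ eq
map-≡⇒≡-on-∈ {xs = _ ∷ _} eq (there x∈) = map-≡⇒≡-on-∈ (Vec.∷-injectiveʳ eq) x∈

another : ∀ {n} → 2 ≤ n → (x : Fin n) → ∃ λ y → y ≢ x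
another (s≤s (s≤s _)) x = punchIn x zero , punchInᵢ≢i x zero

module _ (G : Graph) where
  open Graph G

  adj⇒≢ : ∀ {x y} → adj x y ≡ true → x ≢ y
  adj⇒≢ {x} x~x refl = contradiction (trans (sym x~x) (adj-irr x)) λ ()

  neighbour : 2 ≤ n → ∀ x → ∃ λ y → adj x y ≡ true
  neighbour 2≤n x with another 2≤n x
  ... | y , y≢x = first-step (connected x y) (≢-sym y≢x)
    where
    first-step : ∀ {u v} → Reachable adj u v → u ≢ v → ∃ λ w → adj u w ≡ true
    first-step here           u≢u = contradiction refl u≢u
    first-step (step {y = w} e _) _ = w , e

  probe-self : ∀ x → probe G x x ≡ onV
  probe-self x with x Fin.≟ x
  ... | yes _   = refl
  ... | no x≢x = contradiction refl x≢x

  probe≡onV⇒≡ : ∀ {x r} → probe G x r ≡ onV → x ≡ r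
  probe≡onV⇒≡ {x} {r} eq with x Fin.≟ r
  ... | yes x≡r = x≡r
  ... | no _    = contradiction eq (distant (adj x r))
    where
    distant : ∀ a → (if a then adjV {G} else farV) ≢ onV
    distant true  ()
    distant false ()

  probe-≢ : ∀ {x r} → x ≢ r → probe G x r ≡ (if adj x r then adjV else farV)
  probe-≢ {x} {r} x≢r with x Fin.≟ r
  ... | yes x≡r = contradiction x≡r x≢r
  ... | no _    = refl

  probe-adj-cong : ∀ {x r r'} → x ≢ r → x ≢ r' → probe G x r ≡ probe G x r' → adj x r ≡ adj x r'
  probe-adj-cong {x} {r} {r'} x≢r x≢r' eq =
    answer-injective (adj x r) (adj x r') (trans (sym (probe-≢ x≢r)) (trans eq (probe-≢ x≢r')))
    where
    answer-injective : ∀ a b → (if a then adjV {G} else farV) ≡ (if b then adjV else farV) → a ≡ b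
    answer-injective true  true  _ = refl
    answer-injective false false _ = refl
    answer-injective true  false ()
    answer-injective false true  ()

  module Sweep (rank : Fin n → ℕ) where

    -- After round t the vertices of rank at most t are cleared.
    Escape : ℕ → Fin n → Fin n → Set
    Escape t z z' = t ≤ rank z × InClosedNbhd G z z' × rank z' ≤ t

    data Guard (t : ℕ) (Q : Subset n) : Set where
      guard-all     : (∀ {z z'} → Escape t z z' → z ∈ Q) → Guard t Q
      -- y is left unprobed; the answer of the probe at x tells whether the robber is on y.
      guard-all-but : ∀ {x y} → x ∈ Q → rank x ≤ t → adj x y ≡ true →
                      (∀ {z z'} → Escape t z z' → z ∈ Q ⊎ z ≡ y) → Guard t Q

    record Round (k t : ℕ) : Set where
      constructor round
      field
        probed    : Subset n
        ∣probed∣≤k : ∣ probed ∣ ≤ k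
        guard     : Guard t probed

    module _ {k : ℕ} (d : Fin n) (plan : ∀ t → Round k t) where
      open Round

      Q : ℕ → Subset n
      Q t = probed (plan t)

      probes : ℕ → Vec (Fin n) k
      probes t = padRight (∣probed∣≤k (plan t)) d (elements (Q t))

      sweep : Strategy G k
      sweep h = probes (length h)

      length-history : ∀ v t → length (history G sweep v t) ≡ t
      length-history v ℕ.zero  = refl
      length-history v (suc t) = cong suc (length-history v t)

      Indistinguishable : (ℕ → Fin n) → (ℕ → Fin n) → ℕ → Set
      Indistinguishable u v t = history G sweep u t ≡ history G sweep v t

      answers-agree : ∀ {u v t x} → Indistinguishable u v (suc t) → x ∈ Q t →
                      probe G x (u t) ≡ probe G x (v t)
      answers-agree {u} {v} {t} eq x∈Q =
        map-≡⇒≡-on-∈ same (∈-padRight (∣probed∣≤k (plan t)) d (∈-elements x∈Q))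
        where
        answers : (ℕ → Fin n) → ℕ → Vec (Resp G) k
        answers w i = Vec.map (λ p → probe G p (w t)) (probes i)

        same : answers u t ≡ answers v t
        same = subst₂ (λ i j → answers u i ≡ answers v j)
                 (length-history u t) (length-history v t) (∷-injectiveˡ eq)

      Confined : RobberWalk G → ℕ → Set
      Confined (v , _) t = ∀ (u : RobberWalk G) → Indistinguishable (proj₁ u) v t → t ≤ rank (proj₁ u t)

      sweep-step : ∀ v t → Confined v t → LocatedAt G sweep (proj₁ v) t ⊎ Confined v (suc t)
      sweep-step (v , moves) t confined with v t ∈? Q t
      ... | yes vₜ∈Q = inj₁ λ u eq →
              sym (probe≡onV⇒≡ (trans (answers-agree eq vₜ∈Q) (probe-self (v t))))
      ... | no vₜ∉Q = guarded (guard (plan t))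
        where
        unprobed : ∀ {u} → Indistinguishable u v (suc t) → u t ∉ Q t
        unprobed {u} eq uₜ∈Q = vₜ∉Q (subst (_∈ Q t)
          (probe≡onV⇒≡ (trans (sym (answers-agree eq uₜ∈Q)) (probe-self (u t)))) uₜ∈Q)

        stays-uncleared : ∀ u → Indistinguishable (proj₁ u) v (suc t) →
                          ¬ Escape t (proj₁ u t) (proj₁ u (suc t)) → suc t ≤ rank (proj₁ u (suc t))
        stays-uncleared u eq no-escape =
          ≰⇒> λ cleared → no-escape (confined u (∷-injectiveʳ eq) , proj₂ u t , cleared)

        sentinel : ∀ {x u} → x ∈ Q t → Indistinguishable u v (suc t) → adj x (u t) ≡ adj x (v t)
        sentinel x∈Q eq = probe-adj-cong (probed≢ (unprobed eq)) (probed≢ vₜ∉Q) (answers-agree eq x∈Q)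
          where
          probed≢ : ∀ {z} → z ∉ Q t → _ ≢ z
          probed≢ z∉Q x≡z = z∉Q (subst (_∈ Q t) x≡z x∈Q)

        guarded : Guard t (Q t) → LocatedAt G sweep v t ⊎ Confined (v , moves) (suc t)
        guarded (guard-all guards) = inj₂ λ u eq → stays-uncleared u eq λ esc → unprobed eq (guards esc)
        guarded (guard-all-but {x} {y} x∈Q x-cleared x~y guards) with adj x (v t) in x~vₜ
        ... | true  = inj₁ λ u eq → trans (on-y u eq) (sym (on-y (v , moves) refl))
          where
          on-y : ∀ u → Indistinguishable (proj₁ u) v (suc t) → proj₁ u t ≡ y
          on-y u eq with guards (confined u (∷-injectiveʳ eq) , inj₂ uₜ~x , x-cleared)
            where
            uₜ~x : adj (proj₁ u t) x ≡ true
            uₜ~x = trans (adj-sym _ x) (trans (sentinel x∈Q eq) x~vₜ)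
          ... | inj₁ uₜ∈Q = contradiction uₜ∈Q (unprobed eq)
          ... | inj₂ uₜ≡y = uₜ≡y
        ... | false = inj₂ λ u eq → stays-uncleared u eq λ esc → [ unprobed eq , not-y eq ] (guards esc)
          where
          not-y : ∀ {u} → Indistinguishable u v (suc t) → u t ≢ y
          not-y {u} eq uₜ≡y = contradiction
            (trans (sym x~y) (trans (cong (adj x) (sym uₜ≡y)) (trans (sentinel x∈Q eq) x~vₜ))) λ ()

      confined-until-located : ∀ v t → (∃[ s ] LocatedAt G sweep (proj₁ v) s) ⊎ Confined v t
      confined-until-located v ℕ.zero = inj₂ λ _ _ → z≤n
      confined-until-located v (suc t) with confined-until-located v t
      ... | inj₁ located = inj₁ located
      ... | inj₂ confined with sweep-step v t confined
      ...   | inj₁ located   = inj₁ (t , located)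
      ...   | inj₂ confined′ = inj₂ confined′

      sweep-wins : ∀ N → (∀ z → rank z < N) → CopsWin G k
      sweep-wins N rank<N = sweep , λ v → [ (λ located → located) , (λ confined →
          contradiction (confined v refl) (<⇒≱ (rank<N (proj₁ v N)))) ]
        (confined-until-located v N)

  module FromPathDecomposition (D : PathDecomposition G) {w : ℕ}
                               (narrow : ∀ i → ∣ PathDecomposition.bag D i ∣ ≤ suc w) where
    open PathDecomposition D

    lastBag-spec : ∀ u → ∃ λ j → u ∈ bag j × ∀ {i} → u ∈ bag i → i Fin.≤ j
    lastBag-spec u = maxBy toℕ (λ i → u ∈? bag i) (covers u)

    lastBag : Fin n → Fin m
    lastBag u = proj₁ (lastBag-spec u)

    ∈-lastBag : ∀ u → u ∈ bag (lastBag u)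
    ∈-lastBag u = proj₁ (proj₂ (lastBag-spec u))

    ≤-lastBag : ∀ {u i} → u ∈ bag i → i Fin.≤ lastBag u
    ≤-lastBag {u} = proj₂ (proj₂ (lastBag-spec u))

    rank : Fin n → ℕ
    rank u = toℕ (combine (lastBag u) u)

    rank<m*n : ∀ u → rank u < m * n
    rank<m*n u = toℕ<n (combine (lastBag u) u)

    rank-injective : ∀ {u v} → rank u ≡ rank v → u ≡ v
    rank-injective {u} {v} eq = combine-injectiveʳ (lastBag u) u (lastBag v) v (toℕ-injective eq)

    rank-≤⇒lastBag-≤ : ∀ {u v} → rank u ≤ rank v → lastBag u Fin.≤ lastBag v
    rank-≤⇒lastBag-≤ {u} {v} u≤v = ≮⇒≥ λ v<u → <⇒≱ (combine-monoˡ-< v u v<u) u≤v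

    ∈-lastBag-between : ∀ {z z' p} → InClosedNbhd G z z' → rank z' ≤ rank p → rank p ≤ rank z →
                        z ∈ bag (lastBag p)
    ∈-lastBag-between {z} {p = p} (inj₁ refl) z≤p p≤z =
      subst (_∈ bag (lastBag p)) (rank-injective (≤-antisym p≤z z≤p)) (∈-lastBag p)
    ∈-lastBag-between {z} {z'} {p} (inj₂ z~z') z'≤p p≤z with edges z z' z~z'
    ... | i , z∈i , z'∈i = interp i (lastBag z) (lastBag p)
            (≤-trans (≤-lastBag z'∈i) (rank-≤⇒lastBag-≤ z'≤p)) (rank-≤⇒lastBag-≤ p≤z)
            (x∈p∩q⁺ (z∈i , ∈-lastBag z))

    ∣bag-x∣≤w : ∀ {i x} → x ∈ bag i → ∣ bag i - x ∣ ≤ w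
    ∣bag-x∣≤w {i} x∈i = ≤-pred (≤-trans (x∈p⇒∣p-x∣<∣p∣ x∈i) (narrow i))

    latest : ∀ {t} → ∃ (λ f → rank f < t) → ∃ λ p → rank p < t × ∀ {f} → rank f < t → rank f ≤ rank p
    latest {t} = maxBy rank (λ f → rank f <? t)

    frontierOf : ∀ {t} → Dec (∃ λ f → rank f < t) → Subset n
    frontierOf (yes cleared) = bag (lastBag (proj₁ (latest cleared))) - proj₁ (latest cleared)
    frontierOf (no _)        = ⊥

    frontier : ℕ → Subset n
    frontier t = frontierOf (any? λ f → rank f <? t)

    ∣frontier∣≤w : ∀ t → ∣ frontier t ∣ ≤ w
    ∣frontier∣≤w t = bound (any? λ f → rank f <? t)
      where
      bound : (cleared? : Dec (∃ λ f → rank f < t)) → ∣ frontierOf cleared? ∣ ≤ w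
      bound (yes cleared) = ∣bag-x∣≤w (∈-lastBag (proj₁ (latest cleared)))
      bound (no _)        = subst (_≤ w) (sym (∣⊥∣≡0 n)) z≤n

    frontier-complete : ∀ {t z f} → t ≤ rank z → rank f < t → adj z f ≡ true → z ∈ frontier t
    frontier-complete {t} {z} {f} t≤z f<t z~f = complete (any? λ f → rank f <? t)
      where
      complete : (cleared? : Dec (∃ λ f → rank f < t)) → z ∈ frontierOf cleared?
      complete (no none) = contradiction (f , f<t) none
      complete (yes cleared) = from-latest (latest cleared)
        where
        from-latest : (latest : ∃ λ p → rank p < t × ∀ {f} → rank f < t → rank f ≤ rank p) →
                      z ∈ bag (lastBag (proj₁ latest)) - proj₁ latest
        from-latest (p , p<t , greatest) =
          x∈p∧x≢y⇒x∈p-y (∈-lastBag-between (inj₂ z~f) (greatest f<t) (<⇒≤ (<-≤-trans p<t t≤z))) z≢p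
          where
          z≢p : z ≢ p
          z≢p refl = <⇒≱ p<t t≤z

    open Sweep rank

    plan : 2 ≤ n → ∀ t → Round w t
    plan 2≤n t with any? (λ x → any? (λ y →
                      (rank x ℕ.≟ t) ×-dec (adj x y Bool.≟ true) ×-dec (t ≤? rank y)))
    ... | yes (x , y , refl , x~y , x≤y) =
      round (bag (lastBag x) - y) (∣bag-x∣≤w y∈)
            (guard-all-but (x∈p∧x≢y⇒x∈p-y (∈-lastBag x) (adj⇒≢ x~y)) ≤-refl x~y guards)
      where
      y∈ : y ∈ bag (lastBag x)
      y∈ = ∈-lastBag-between (inj₂ (trans (adj-sym y x) x~y)) ≤-refl x≤y

      guards : ∀ {z z'} → Escape (rank x) z z' → z ∈ bag (lastBag x) - y ⊎ z ≡ y
      guards {z} (x≤z , move , z'≤x) with z Fin.≟ y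
      ... | yes z≡y = inj₂ z≡y
      ... | no z≢y  = inj₁ (x∈p∧x≢y⇒x∈p-y (∈-lastBag-between move z'≤x x≤z) z≢y)
    ... | no none = round (frontier t) (∣frontier∣≤w t) (guard-all guards)
      where
      guards : ∀ {z z'} → Escape t z z' → z ∈ frontier t
      guards {z} (t≤z , inj₁ refl , z≤t) with neighbour 2≤n z
      ... | a , z~a with t ≤? rank a
      ...   | yes t≤a = contradiction (z , a , ≤-antisym z≤t t≤z , z~a , t≤a) none
      ...   | no  t≰a = frontier-complete t≤z (≰⇒> t≰a) z~a
      guards {z} {z'} (t≤z , inj₂ z~z' , z'≤t) with m≤n⇒m<n∨m≡n z'≤t
      ... | inj₁ z'<t = frontier-complete t≤z z'<t z~z'
      ... | inj₂ z'≡t = contradiction (z' , z , z'≡t , trans (adj-sym z' z) z~z' , t≤z) none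

    1≤w : 2 ≤ n → 1 ≤ w
    1≤w 2≤n with neighbour 2≤n (Fin.fromℕ< 2≤n)
    ... | y , x~y with edges _ y x~y
    ... | i , x∈i , y∈i = ≤-trans
      (≤-trans (s≤s z≤n) (x∈p⇒∣p-x∣<∣p∣ (x∈p∧x≢y⇒x∈p-y y∈i (≢-sym (adj⇒≢ x~y)))))
      (∣bag-x∣≤w x∈i)


mainTheorem8 : (G : Graph) → 2 ≤ Graph.n G →
    ∀ (w : ℕ) → IsPathwidth G w → ∃[ k ] (1 ≤ k × k ≤ w × CopsWin G k)
mainTheorem8 G 2≤n w ((D , narrow) , _) =
  w , 1≤w 2≤n , ≤-refl , sweep-wins (Fin.fromℕ< 2≤n) (plan 2≤n) (m * n) rank<m*n
  where
  open Graph G using (n)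
  open PathDecomposition D using (m)
  open FromPathDecomposition G D narrow
  open Sweep G rank
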